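{- Let $G$ be a finite simple graph. If $X$ and $Y$ are two critical independent sets of $G$, then $|N(X)\cap Y| = |N(Y)\cap X|$.
   Context: For $A\subseteq V(G)$, $N(A)$ is the set of vertices adjacent to some vertex of $A$, $d(A)=|A|-|N(A)|$, $d_c(G)=\max\{d(A):A\subseteq V(G)\}$, and $A$ is critical if $d(A)=d_c(G)$. -}

module Defs where

open import Data.Bool using (Bool; true; false; _∧_; T)
open import Data.Bool.Properties using (T?)
open import Data.Nat using (ℕ)
open import Data.Fin using (Fin)
open import Data.Fin.Subset using (Subset; _∈_; ∣_∣)
open import Data.Fin.Properties using (any?)
open import Data.Vec using (tabulate; lookup)
open import Data.Integer using (ℤ; _-_; _≤_; +_)
open import Data.Product using (∃; _×_)
open import Relation.Nullary using (¬_; does)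
open import Relation.Binary.PropositionalEquality using (_≡_)

record Graph (n : ℕ) : Set where
  field
    adj   : Fin n → Fin n → Bool
    sym   : ∀ u v → adj u v ≡ adj v u
    irrefl : ∀ v → adj v v ≡ false

open Graph public

Adj : ∀ {n} → Graph n → Fin n → Fin n → Set
Adj G u v = adj G u v ≡ true

N : ∀ {n} → Graph n → Subset n → Subset n
N G A = tabulate λ v → does (any? λ u → T? (lookup A u ∧ adj G u v))

d : ∀ {n} → Graph n → Subset n → ℤ
d G A = + ∣ A ∣ - + ∣ N G A ∣

Critical : ∀ {n} → Graph n → Subset n → Set
Critical G A = ∀ (B : Subset _) → d G B ≤ d G A

Independent : ∀ {n} → Graph n → Subset n → Set
Independent G A = ∀ u v → u ∈ A → v ∈ A → ¬ Adj G u v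

-- Let X′ = X ─ N(Y). A neighbour of X′ lying in Y would put a vertex of X′ into N(Y),
-- so N(X′) ⊆ N(X) ─ Y. Criticality of X gives d(X′) ≤ d(X), i.e.
-- |N(X)| − |N(X′)| ≤ |X| − |X′| = |N(Y) ∩ X|, while the inclusion gives
-- |N(X)| − |N(X′)| ≥ |N(X) ∩ Y|. Swapping X and Y yields the reverse inequality.
module Submission where

open import Defs
open import Data.Bool using (true; _∧_; T)
open import Data.Bool.Properties using (T?; T-≡; T-∧)
open import Data.Fin using (Fin)
open import Data.Fin.Properties using (any?)
open import Data.Fin.Subset
  using (Subset; inside; outside; _∈_; _∉_; _⊆_; _∩_; _─_; ∣_∣)
open import Data.Fin.Subset.Properties
  using (p─q⊆p; x∈p∧x∉q⇒x∈p─q; p⊆q⇒∣p∣≤∣q∣; ∩-comm)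
open import Data.Integer as ℤ using (ℤ; +_; _-_) renaming (_+_ to _⊕_; _≤_ to _≤ℤ_)
import Data.Integer.Properties as ℤ
open import Data.Integer.Tactic.RingSolver using (solve-∀)
open import Data.Nat as ℕ using (ℕ; _+_; _≤_)
open import Data.Nat.Properties
  using ( +-suc; +-assoc; +-commutativeSemigroup; +-monoʳ-≤; +-cancelˡ-≤; ≤-antisym
        ; module ≤-Reasoning)
open import Algebra.Properties.CommutativeSemigroup +-commutativeSemigroup
  using (xy∙z≈xz∙y)
open import Data.Product using (∃; _×_; _,_)
open import Data.Vec using (_∷_; []; here; there; lookup)
open import Data.Vec.Properties using (lookup∘tabulate; []=⇒lookup; lookup⇒[]=)
open import Function using (Equivalence)
open import Relation.Nullary using (Dec; isYes)
open import Relation.Nullary.Decidable using (dec-true; toWitness; isYes≗does)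
open import Relation.Binary.PropositionalEquality
  using (_≡_; refl; cong; trans; subst₂) renaming (sym to ≡-sym)

open Equivalence using (to; from)

+m-+n≤+o-+p⇒m+p≤o+n : ∀ m n o p → + m - + n ≤ℤ + o - + p → m + p ≤ o + n
+m-+n≤+o-+p⇒m+p≤o+n m n o p le = ℤ.drop‿+≤+ (subst₂ _≤ℤ_
  (trans (cancelˡ (+ m) (+ n) (+ p)) (≡-sym (ℤ.pos-+ m p)))
  (trans (cancelʳ (+ o) (+ n) (+ p)) (≡-sym (ℤ.pos-+ o n)))
  (ℤ.+-monoˡ-≤ (+ n ⊕ + p) le))
  where
  cancelˡ : ∀ (x y z : ℤ) → (x - y) ⊕ (y ⊕ z) ≡ x ⊕ z
  cancelˡ = solve-∀
  cancelʳ : ∀ (x y z : ℤ) → (x - z) ⊕ (y ⊕ z) ≡ x ⊕ y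
  cancelʳ = solve-∀

x∈p─q⇒x∉q : ∀ {n} {x : Fin n} {p q : Subset n} → x ∈ p ─ q → x ∉ q
x∈p─q⇒x∉q {p = _ ∷ _} {outside ∷ _} here        ()
x∈p─q⇒x∉q {p = _ ∷ _} {_ ∷ _}       (there x∈) (there x∈q) = x∈p─q⇒x∉q x∈ x∈q

∣p∣≡∣p─q∣+∣p∩q∣ : ∀ {n} (p q : Subset n) → ∣ p ∣ ≡ ∣ p ─ q ∣ + ∣ p ∩ q ∣
∣p∣≡∣p─q∣+∣p∩q∣ []            []            = refl
∣p∣≡∣p─q∣+∣p∩q∣ (inside ∷ p)  (inside ∷ q)  =
  trans (cong ℕ.suc (∣p∣≡∣p─q∣+∣p∩q∣ p q)) (≡-sym (+-suc _ _))
∣p∣≡∣p─q∣+∣p∩q∣ (inside ∷ p)  (outside ∷ q) = cong ℕ.suc (∣p∣≡∣p─q∣+∣p∩q∣ p q)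
∣p∣≡∣p─q∣+∣p∩q∣ (outside ∷ p) (inside ∷ q)  = ∣p∣≡∣p─q∣+∣p∩q∣ p q
∣p∣≡∣p─q∣+∣p∩q∣ (outside ∷ p) (outside ∷ q) = ∣p∣≡∣p─q∣+∣p∩q∣ p q

module _ {n} (G : Graph n) where

  hasNeighbourIn? : ∀ (A : Subset n) v → Dec (∃ λ u → T (lookup A u ∧ adj G u v))
  hasNeighbourIn? A v = any? λ u → T? (lookup A u ∧ adj G u v)

  ∈N⁺ : ∀ {A : Subset n} {u v} → u ∈ A → Adj G u v → v ∈ N G A
  ∈N⁺ {A} {u} {v} u∈A u~v = lookup⇒[]= v (N G A)
    (trans (lookup∘tabulate _ v) (dec-true (hasNeighbourIn? A v) witness))
    where witness = u , from T-∧ (from T-≡ ([]=⇒lookup u∈A) , from T-≡ u~v)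

  ∈N⁻ : ∀ (A : Subset n) {v} → v ∈ N G A → ∃ λ u → u ∈ A × Adj G u v
  ∈N⁻ A {v} v∈NA with toWitness {a? = hasNeighbourIn? A v} (from T-≡ isYes-true)
    where
    isYes-true : isYes (hasNeighbourIn? A v) ≡ true
    isYes-true = trans (isYes≗does (hasNeighbourIn? A v))
      (trans (≡-sym (lookup∘tabulate _ v)) ([]=⇒lookup v∈NA))
  ... | u , both with to T-∧ both
  ...   | u∈A , u~v = u , lookup⇒[]= u A (to T-≡ u∈A) , to T-≡ u~v

  N-mono : ∀ {A B : Subset n} → A ⊆ B → N G A ⊆ N G B
  N-mono {A} A⊆B v∈NA with ∈N⁻ A v∈NA
  ... | u , u∈A , u~v = ∈N⁺ (A⊆B u∈A) u~v

  N[A─N[B]]⊆N[A]─B : ∀ (A B : Subset n) → N G (A ─ N G B) ⊆ N G A ─ B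
  N[A─N[B]]⊆N[A]─B A B {v} v∈ with ∈N⁻ (A ─ N G B) v∈
  ... | u , u∈A─NB , u~v =
    x∈p∧x∉q⇒x∈p─q (N-mono (p─q⊆p A (N G B)) v∈)
      (λ v∈B → x∈p─q⇒x∉q u∈A─NB (∈N⁺ v∈B (trans (Graph.sym G v u) u~v)))

  Critical⇒∣B∣+∣N[A]∣≤∣A∣+∣N[B]∣ : ∀ {A} → Critical G A →
    ∀ B → ∣ B ∣ + ∣ N G A ∣ ≤ ∣ A ∣ + ∣ N G B ∣
  Critical⇒∣B∣+∣N[A]∣≤∣A∣+∣N[B]∣ {A} critical B =
    +m-+n≤+o-+p⇒m+p≤o+n (∣ B ∣) (∣ N G B ∣) (∣ A ∣) (∣ N G A ∣) (critical B)

  Critical⇒∣N[X]∩Y∣≤∣N[Y]∩X∣ : ∀ {X} Y → Critical G X → ∣ N G X ∩ Y ∣ ≤ ∣ N G Y ∩ X ∣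
  Critical⇒∣N[X]∩Y∣≤∣N[Y]∩X∣ {X} Y critical = +-cancelˡ-≤ (∣ X′ ∣ + ∣ N G X ─ Y ∣) _ _ (begin
    ∣ X′ ∣ + ∣ N G X ─ Y ∣ + ∣ N G X ∩ Y ∣   ≡⟨ +-assoc ∣ X′ ∣ _ _ ⟩
    ∣ X′ ∣ + (∣ N G X ─ Y ∣ + ∣ N G X ∩ Y ∣) ≡⟨ cong (_+_ ∣ X′ ∣) (∣p∣≡∣p─q∣+∣p∩q∣ (N G X) Y) ⟨
    ∣ X′ ∣ + ∣ N G X ∣                       ≤⟨ Critical⇒∣B∣+∣N[A]∣≤∣A∣+∣N[B]∣ {X} critical X′ ⟩
    ∣ X ∣ + ∣ N G X′ ∣                       ≤⟨ +-monoʳ-≤ ∣ X ∣ (p⊆q⇒∣p∣≤∣q∣ (N[A─N[B]]⊆N[A]─B X Y)) ⟩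
    ∣ X ∣ + ∣ N G X ─ Y ∣                    ≡⟨ cong (_+ ∣ N G X ─ Y ∣) X-split ⟩
    ∣ X′ ∣ + ∣ N G Y ∩ X ∣ + ∣ N G X ─ Y ∣   ≡⟨ xy∙z≈xz∙y ∣ X′ ∣ _ _ ⟩
    ∣ X′ ∣ + ∣ N G X ─ Y ∣ + ∣ N G Y ∩ X ∣   ∎)
    where
    open ≤-Reasoning
    X′ = X ─ N G Y
    X-split : ∣ X ∣ ≡ ∣ X′ ∣ + ∣ N G Y ∩ X ∣
    X-split = trans (∣p∣≡∣p─q∣+∣p∩q∣ X (N G Y)) (cong (_+_ ∣ X′ ∣) (cong ∣_∣ (∩-comm X (N G Y))))

lemma3p1 : ∀ {n : ℕ} (G : Graph n) (X Y : Subset n) →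
    Independent G X → Critical G X →
    Independent G Y → Critical G Y →
    ∣ N G X ∩ Y ∣ ≡ ∣ N G Y ∩ X ∣
lemma3p1 G X Y _ X-critical _ Y-critical =
  ≤-antisym (Critical⇒∣N[X]∩Y∣≤∣N[Y]∩X∣ G Y X-critical) (Critical⇒∣N[X]∩Y∣≤∣N[Y]∩X∣ G X Y-critical)
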